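{- Let $H$ be a graph containing adjacent vertices $u,v$, and let $H'=H-\{u,v\}$ be $4$-colorable. Suppose $u$ has exactly one neighbor $x$ in $V(H')$ and $v$ has exactly one neighbor $y$ in $V(H')$, with $y\neq x$. If $h_4(H')=1$, then $h_4(H)=1$.
   Context: For a graph $H$ and $k\geq\chi(H)$, a proper $k$-coloring is a map $V(H)\to[k]$ giving adjacent vertices different colors. For a positive integer $j$, $G^j_k(H)$ has the proper $k$-colorings of $H$ as vertices, two distinct colorings adjacent if $H$ contains a connected subgraph on at most $j$ vertices containing all vertices where they differ (so $G^1_k(H)$ joins colorings differing on exactly one vertex); $h_k(H)$ is the least $j\geq1$ with $G^j_k(H)$ Hamiltonian. -}

module Defs where

open import Data.Nat using (ℕ; zero; suc; _≤_)
open import Data.Fin using (Fin; punchIn; punchOut)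
open import Data.Fin.Subset using (Subset; _∈_; ∣_∣)
open import Data.Product using (Σ; ∃; _×_; _,_)
open import Relation.Binary.PropositionalEquality using (_≡_; _≢_)
open import Relation.Nullary using (¬_)
open import Data.Empty using (⊥)
open import Data.Nat using (_<_)
open import Data.Fin using (toℕ)
import Data.Nat
import Data.Fin
import Relation.Nullary

record Graph (n : ℕ) : Set₁ where
  field
    E     : Fin n → Fin n → Set
    sym   : ∀ {a b} → E a b → E b a
    irrefl : ∀ {a} → ¬ E a a
open Graph public

removeVertex : ∀ {n} → Graph (suc n) → Fin (suc n) → Graph n
removeVertex H w = record
  { E = λ a b → E H (punchIn w a) (punchIn w b)
  ; sym = sym H
  ; irrefl = irrefl H }

removeTwo : ∀ {n} → Graph (suc (suc n)) → (u v : Fin (suc (suc n))) → u ≢ v → Graph n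
removeTwo H u v u≢v = removeVertex (removeVertex H u) (punchOut u≢v)

Coloring : ℕ → ℕ → Set
Coloring n k = Fin n → Fin k

Proper : ∀ {n} → Graph n → ∀ {k} → Coloring n k → Set
Proper H c = ∀ a b → E H a b → c a ≢ c b

Colorable : ∀ {n} → Graph n → ℕ → Set
Colorable {n} H k = Σ (Coloring n k) (Proper H)

data WalkIn {n} (H : Graph n) (S : Subset n) : Fin n → Fin n → Set where
  here : ∀ {a} → a ∈ S → WalkIn H S a a
  step : ∀ {a c b} → a ∈ S → E H a c → WalkIn H S c b → WalkIn H S a b

ConnectedIn : ∀ {n} → Graph n → Subset n → Set
ConnectedIn H S = ∀ a b → a ∈ S → b ∈ S → WalkIn H S a b

-- Adjacency in G^j_k(H): distinct colorings c, d such that some connected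
-- subgraph of H on at most j vertices contains all vertices where they differ.
AdjG : ∀ {n} → Graph n → ∀ {k} → ℕ → Coloring n k → Coloring n k → Set
AdjG {n} H j c d =
  (∃ λ w → c w ≢ d w) ×
  (Σ (Subset n) λ S → (∣ S ∣ ≤ j) × ConnectedIn H S × (∀ w → c w ≢ d w → w ∈ S))

-- G^j_k(H) is Hamiltonian: there is a cyclic ordering cyc 0, …, cyc (m-1)
-- (m ≥ 3) of all proper k-colorings of H (colorings compared pointwise),
-- each exactly once, with cyclically consecutive ones adjacent in G^j_k(H).
PointwiseEq : ∀ {n k} → Coloring n k → Coloring n k → Set
PointwiseEq c d = ∀ w → c w ≡ d w

nextIdx : ∀ {m} → Fin m → Fin m
nextIdx {suc m} i with suc (toℕ i) Data.Nat.≟ suc m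
... | Relation.Nullary.yes _ = Fin.zero
... | Relation.Nullary.no ne = Data.Fin.fromℕ< (Data.Nat.Properties.≤∧≢⇒< (Data.Fin.Properties.toℕ<n i) ne)
  where import Data.Nat.Properties
        import Data.Fin.Properties

HamiltonianG : ∀ {n} → Graph n → ℕ → ℕ → Set
HamiltonianG {n} H k j =
  Σ ℕ λ m → (3 ≤ m) × Σ (Fin m → Coloring n k) λ cyc →
    (∀ i → Proper H (cyc i)) ×
    (∀ c → Proper H c → ∃ λ i → PointwiseEq (cyc i) c) ×
    (∀ i i' → PointwiseEq (cyc i) (cyc i') → i ≡ i') ×
    (∀ i → AdjG H j (cyc i) (cyc (nextIdx i)))

hIs : ∀ {n} → Graph n → ℕ → ℕ → Set
hIs H k j = (1 ≤ j) × HamiltonianG H k j × (∀ j' → 1 ≤ j' → j' < j → ¬ HamiltonianG H k j')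

UniqueNbrOutside : ∀ {n} → Graph n → (z u v w : Fin n) → Set
UniqueNbrOutside H z u v w =
  w ≢ u × w ≢ v × E H z w × (∀ w' → w' ≢ u → w' ≢ v → E H z w' → w' ≡ w)

module Submission where

-- From a
-- Hamiltonian cycle c₀, c₁, …, c_m of G¹₄(H') we build one of G¹₄(H).
--
-- A proper 4-colouring of H is a colouring cᵢ of H' together with a pair (p , q)
-- of colours for (u , v) that fits the frame τᵢ = (cᵢ x , cᵢ y): p ≢ cᵢ x, q ≢ cᵢ y,
-- p ≢ q.  Single-vertex steps either recolour u or v (moving inside the block of
-- pairs fitting τᵢ), or move from cᵢ to cᵢ₊₁ keeping (p , q).  The new cycle
-- visits the blocks in the order of the old one, running through each block along a
-- Hamiltonian path and leaving it through a pair that also fits the next frame.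
-- All facts about 4 colours this needs (Hamiltonian paths between suitable ends,
-- a greedy choice of exits, and a "window" closing the cycle at three consecutive
-- frames, the first with cᵢ x ≢ cᵢ y) are decided by exhaustive computation.

open import Defs hiding (sym)
open import Data.Bool using (Bool; true; false; _∧_; _∨_; T; if_then_else_)
open import Data.Empty using (⊥-elim)
open import Data.Fin using (Fin; zero; suc; toℕ; fromℕ; inject₁; opposite; punchIn; punchOut)
open import Data.Fin.Properties
  using (_≟_; any?; toℕ-injective; toℕ-fromℕ; toℕ-inject₁; toℕ<n; toℕ-fromℕ<; opposite-involutive;
         punchIn-injective; punchInᵢ≢i; punchOut-injective; punchIn-punchOut)
import Data.Fin.Relation.Unary.Top as Top
open import Data.Fin.Subset using (Subset; inside; outside; ⁅_⁆; ∣_∣) renaming (_∈_ to _∈ₛ_)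
open import Data.Fin.Subset.Properties using (x∈⁅x⁆; x∈⁅y⁆⇒x≡y; ∣⁅x⁆∣≡1)
open import Data.List using (List; []; _∷_; _++_; map; length; lookup; tabulate; allFin; filter; foldr; cartesianProduct)
open import Data.List.Membership.Propositional using (_∈_)
open import Data.List.Membership.Propositional.Properties
  using (∈-∃++; ∈-lookup; ∈-allFin; ∈-cartesianProduct⁺; ∈-map⁺; ∈-map⁻; ∈-++⁺ˡ; ∈-++⁺ʳ; ∈-++⁻)
open import Data.List.Membership.DecPropositional using (_∈?_)
open import Data.List.Properties using (length-map; length-++; length-tabulate)
open import Data.List.Relation.Binary.Permutation.Propositional using (_↭_; ↭-refl; ↭⇒↭ₛ)
open import Data.List.Relation.Binary.Permutation.Propositional.Properties using (++-comm; ∈-resp-↭; ↭-length)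
import Data.List.Relation.Binary.Permutation.Setoid.Properties as PermutationProperties
open import Data.List.Relation.Unary.All using (All; []; _∷_)
import Data.List.Relation.Unary.All as All
open import Data.List.Relation.Unary.AllPairs using (_∷_)
open import Data.List.Relation.Unary.Any using (Any; here; there; index)
import Data.List.Relation.Unary.Any as Any
open import Data.List.Relation.Unary.Any.Properties using (lookup-index)
open import Data.List.Relation.Unary.Unique.Propositional using (Unique)
import Data.List.Relation.Unary.Unique.Propositional.Properties as Unique
import Data.List.Relation.Unary.Unique.DecPropositional as UniqueDec
open import Data.Maybe using (Maybe; just; nothing; fromMaybe; _<∣>_)
import Data.Maybe as Maybe
open import Data.Nat using (ℕ; zero; suc; _≤_; _<_; z≤n; s≤s; _≤?_) renaming (_≟_ to _≟ℕ_)
open import Data.Nat.Properties using (≤-refl; ≤-trans; ≤-reflexive; <-irrefl; <⇒≱; ≤∧≢⇒<; m≤m+n)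
open import Data.Product using (_×_; _,_; proj₁; proj₂; ∃; ∃-syntax)
open import Data.Product.Properties using (≡-dec)
open import Data.Sum using (_⊎_; inj₁; inj₂)
open import Data.Vec.Base using (_∷_; here; there)
open import Function using (id; _∘_)
open import Relation.Binary.Definitions using (DecidableEquality)
open import Relation.Binary.PropositionalEquality using (_≡_; _≢_; refl; sym; trans; cong; subst; subst₂; setoid)
open import Relation.Nullary using (Dec; does; yes; no; _because_; ¬_; ¬?; contradiction)
open import Relation.Nullary.Decidable using (map′; _×-dec_; _⊎-dec_; _→-dec_; decidable-stable)
open import Relation.Nullary.Reflects using (fromEquivalence)
open import Relation.Unary using (Decidable)

Walk : {A : Set} → (A → A → Set) → A → List A → A → Set
Walk R a []      b = a ≡ b
Walk R a (c ∷ l) b = R a c × Walk R c l b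

Cycle : {A : Set} → (A → A → Set) → A → List A → Set
Cycle R a l = ∃[ b ] (Walk R a l b × R b a)

module _ {A : Set} {R : A → A → Set} where

  walk-++ : ∀ {a b c d} l {l'} → Walk R a l b → R b c → Walk R c l' d → Walk R a (l ++ c ∷ l') d
  walk-++ []      refl     r w = r , w
  walk-++ (_ ∷ l) (r₁ , w₁) r w = r₁ , walk-++ l w₁ r w

  walk-split : ∀ {a c d} l {l'} → Walk R a (l ++ c ∷ l') d → ∃[ b ] (Walk R a l b × R b c × Walk R c l' d)
  walk-split []      (r , w)  = _ , refl , r , w
  walk-split (_ ∷ l) (r₁ , w) with walk-split l w
  ... | b , w₁ , r , w₂ = b , (r₁ , w₁) , r , w₂

  walk-all : {P : A → Set} → (∀ {x y} → P x → R x y → P y) → ∀ {a b} l → P a → Walk R a l b → All P (a ∷ l)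
  walk-all preserve []      pa _       = pa ∷ []
  walk-all preserve (_ ∷ l) pa (r , w) = pa ∷ walk-all preserve l (preserve pa r) w

  cycle-rotate : ∀ {a t l} → Cycle R a l → t ∈ a ∷ l → ∃[ l' ] (Cycle R t l' × (a ∷ l) ↭ (t ∷ l'))
  cycle-rotate cyc (here refl) = _ , cyc , ↭-refl
  cycle-rotate {a} {t} (b , w , r) (there t∈l) with ∈-∃++ t∈l
  ... | xs , zs , refl with walk-split xs w
  ...   | c , w₁ , r₁ , w₂ = zs ++ a ∷ xs , (c , walk-++ zs w₂ r w₁ , r₁) , ++-comm (a ∷ xs) (t ∷ zs)

walk-map : {A B : Set} {R : A → A → Set} {S : B → B → Set} (f : A → B) →
           (∀ {x y} → R x y → S (f x) (f y)) → ∀ {a b} l → Walk R a l b → Walk S (f a) (map f l) (f b)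
walk-map f hom []      refl    = refl
walk-map f hom (_ ∷ l) (r , w) = hom r , walk-map f hom l w

nextIdx-toℕ : ∀ {m} (i : Fin m) → suc (toℕ i) < m → toℕ (nextIdx i) ≡ suc (toℕ i)
nextIdx-toℕ {suc m} i lt with suc (toℕ i) ≟ℕ suc m
... | yes eq = ⊥-elim (<-irrefl eq lt)
... | no ne  = toℕ-fromℕ< (≤∧≢⇒< (toℕ<n i) ne)

nextIdx-last : ∀ {m} (i : Fin (suc m)) → toℕ i ≡ m → nextIdx i ≡ zero
nextIdx-last {m} i eq with suc (toℕ i) ≟ℕ suc m
... | yes _ = refl
... | no ne = ⊥-elim (ne (cong suc eq))

nextIdx-inject₁ : ∀ {m} (j : Fin m) → nextIdx (inject₁ j) ≡ suc j
nextIdx-inject₁ j = toℕ-injective (trans (nextIdx-toℕ (inject₁ j) j+1<) (cong suc (toℕ-inject₁ j)))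
  where
  j+1< : suc (toℕ (inject₁ j)) < suc _
  j+1< = subst (λ k → suc k < suc _) (sym (toℕ-inject₁ j)) (s≤s (toℕ<n j))

nextIdx-fromℕ : ∀ m → nextIdx (fromℕ m) ≡ zero
nextIdx-fromℕ m = nextIdx-last (fromℕ m) (toℕ-fromℕ m)

module _ {A : Set} {R : A → A → Set} where

  walk-lookup-inject₁ : ∀ {a b} l → Walk R a l b → ∀ j → R (lookup (a ∷ l) (inject₁ j)) (lookup (a ∷ l) (suc j))
  walk-lookup-inject₁ (_ ∷ l) (r , w) zero    = r
  walk-lookup-inject₁ (_ ∷ l) (r , w) (suc j) = walk-lookup-inject₁ l w j

  walk-lookup-last : ∀ {a b} l → Walk R a l b → lookup (a ∷ l) (fromℕ (length l)) ≡ b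
  walk-lookup-last []      refl    = refl
  walk-lookup-last (_ ∷ l) (_ , w) = walk-lookup-last l w

  cycle-lookup : ∀ {a l} → Cycle R a l → ∀ j → R (lookup (a ∷ l) j) (lookup (a ∷ l) (nextIdx j))
  cycle-lookup {a} {l} (b , w , r) j with Top.view j
  ... | Top.‵fromℕ = subst₂ R (sym (walk-lookup-last l w)) (cong (lookup (a ∷ l)) (sym (nextIdx-fromℕ (length l)))) r
  ... | Top.‵inject₁ i = subst (R _) (cong (lookup (a ∷ l)) (sym (nextIdx-inject₁ i))) (walk-lookup-inject₁ l w i)

  tabulate-walk : ∀ {n} (g : Fin (suc n) → A) → (∀ j → R (g (inject₁ j)) (g (suc j))) →
                  Walk R (g zero) (tabulate (g ∘ suc)) (g (fromℕ n))
  tabulate-walk {zero}  g related = refl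
  tabulate-walk {suc n} g related = related zero , tabulate-walk (g ∘ suc) (related ∘ suc)

lookup-injective : {A : Set} {xs : List A} → Unique xs → ∀ i j → lookup xs i ≡ lookup xs j → i ≡ j
lookup-injective (_ ∷ _)    zero    zero    _  = refl
lookup-injective (x∉ ∷ _)   zero    (suc j) eq = ⊥-elim (All.lookup x∉ (∈-lookup j) eq)
lookup-injective (x∉ ∷ _)   (suc i) zero    eq = ⊥-elim (All.lookup x∉ (∈-lookup i) (sym eq))
lookup-injective (_ ∷ uniq) (suc i) (suc j) eq = cong suc (lookup-injective uniq i j eq)

allFin-cycle : ∀ {m} {R : Fin (suc m) → Fin (suc m) → Set} → (∀ i → R i (nextIdx i)) → Cycle R zero (tabulate suc)
allFin-cycle {m} {R} next =
  fromℕ m ,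
  tabulate-walk id (λ j → subst (R (inject₁ j)) (nextIdx-inject₁ j) (next (inject₁ j))) ,
  subst (R (fromℕ m)) (nextIdx-fromℕ m) (next (fromℕ m))

hamiltonian-from-cycle :
  ∀ {n k j} {A : Set} {R : A → A → Set} (H : Graph n) (colouring : A → Coloring n k) {a l} →
  Cycle R a l → 3 ≤ length (a ∷ l) → Unique (a ∷ l) →
  (∀ {x y} → R x y → AdjG H j (colouring x) (colouring y)) →
  (∀ x y → PointwiseEq (colouring x) (colouring y) → x ≡ y) →
  (∀ {x} → x ∈ a ∷ l → Proper H (colouring x)) →
  (∀ c → Proper H c → ∃[ x ] (x ∈ a ∷ l × PointwiseEq (colouring x) c)) →
  HamiltonianG H k j
hamiltonian-from-cycle H colouring {a} {l} cyc long uniq adjacent injective proper complete =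
  length (a ∷ l) , long , colouring ∘ lookup (a ∷ l) ,
  (λ i → proper (∈-lookup i)) , covers ,
  (λ i i' eq → lookup-injective uniq i i' (injective _ _ eq)) ,
  (λ i → adjacent (cycle-lookup cyc i))
  where
  covers : ∀ c → Proper H c → ∃ λ i → PointwiseEq (colouring (lookup (a ∷ l) i)) c
  covers c proper-c with complete c proper-c
  ... | x , x∈ , eq = index x∈ , subst (λ z → PointwiseEq (colouring z) c) (lookup-index x∈) eq

DifferOnlyAt : ∀ {n k} → Coloring n k → Coloring n k → Fin n → Set
DifferOnlyAt c d w = c w ≢ d w × (∀ z → c z ≢ d z → z ≡ w)

∈⇒nonempty : ∀ {n} {S : Subset n} {a} → a ∈ₛ S → 1 ≤ ∣ S ∣
∈⇒nonempty {S = inside ∷ _}  _          = s≤s z≤n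
∈⇒nonempty {S = outside ∷ _} (there a∈) = ∈⇒nonempty a∈

∈-subsingleton : ∀ {n} {S : Subset n} {a b} → ∣ S ∣ ≤ 1 → a ∈ₛ S → b ∈ₛ S → a ≡ b
∈-subsingleton {S = outside ∷ _} ∣S∣≤1 (there a∈) (there b∈) = cong suc (∈-subsingleton ∣S∣≤1 a∈ b∈)
∈-subsingleton {S = inside ∷ _}  _ here here = refl
∈-subsingleton {S = inside ∷ _}  (s≤s ∣S∣≤0) here (there b∈) with ≤-trans (∈⇒nonempty b∈) ∣S∣≤0
... | ()
∈-subsingleton {S = inside ∷ _}  (s≤s ∣S∣≤0) (there a∈) _ with ≤-trans (∈⇒nonempty a∈) ∣S∣≤0
... | ()

adjG₁⇒differOnlyAt : ∀ {n k} (H : Graph n) {c d : Coloring n k} → AdjG H 1 c d → ∃ (DifferOnlyAt c d)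
adjG₁⇒differOnlyAt H ((w , cw≢dw) , S , ∣S∣≤1 , _ , differ⊆S) =
  w , cw≢dw , λ z cz≢dz → ∈-subsingleton ∣S∣≤1 (differ⊆S z cz≢dz) (differ⊆S w cw≢dw)

differOnlyAt⇒adjG₁ : ∀ {n k} (H : Graph n) {c d : Coloring n k} {w} → DifferOnlyAt c d w → AdjG H 1 c d
differOnlyAt⇒adjG₁ H {w = w} (cw≢dw , only-w) =
  (w , cw≢dw) , ⁅ w ⁆ , ≤-reflexive (∣⁅x⁆∣≡1 w) , singleton-connected ,
  λ z cz≢dz → subst (_∈ₛ ⁅ w ⁆) (sym (only-w z cz≢dz)) (x∈⁅x⁆ w)
  where
  singleton-connected : ConnectedIn H ⁅ w ⁆
  singleton-connected a b a∈ b∈ with x∈⁅y⁆⇒x≡y w a∈ | x∈⁅y⁆⇒x≡y w b∈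
  ... | refl | refl = here a∈

recolour-proper : ∀ {n k k'} (G : Graph n) {c : Coloring n k} (f : Fin k → Fin k') →
                  (∀ {a b} → f a ≡ f b → a ≡ b) → Proper G c → Proper G (f ∘ c)
recolour-proper G f f-injective c-proper a b e = c-proper a b e ∘ f-injective

-- Colours, and pairs of colours: the colours of (x , y) — a frame — or of (u , v).
Colour : Set
Colour = Fin 4

Pair : Set
Pair = Colour × Colour

_≟ₚ_ : DecidableEquality Pair
_≟ₚ_ = ≡-dec _≟_ _≟_

allPairs : List Pair
allPairs = cartesianProduct (allFin 4) (allFin 4)

∈-allPairs : ∀ p → p ∈ allPairs
∈-allPairs (a , b) = ∈-cartesianProduct⁺ (∈-allFin a) (∈-allFin b)

-- Deciding All and Any over a list by a plain Boolean fold, which evaluates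
-- efficiently during type checking.
module _ {A : Set} {P : A → Set} (P? : Decidable P) where

  allᵇ : List A → Bool
  allᵇ []       = true
  allᵇ (x ∷ xs) = does (P? x) ∧ allᵇ xs

  anyᵇ : List A → Bool
  anyᵇ []       = false
  anyᵇ (x ∷ xs) = does (P? x) ∨ anyᵇ xs

  allᵇ-sound : ∀ xs → T (allᵇ xs) → All P xs
  allᵇ-sound []       _ = []
  allᵇ-sound (x ∷ xs) t with P? x
  ... | yes px = px ∷ allᵇ-sound xs t

  allᵇ-complete : ∀ {xs} → All P xs → T (allᵇ xs)
  allᵇ-complete []                 = _
  allᵇ-complete {x ∷ _} (px ∷ pxs) with P? x
  ... | yes _  = allᵇ-complete pxs
  ... | no ¬px = ¬px px

  anyᵇ-sound : ∀ xs → T (anyᵇ xs) → Any P xs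
  anyᵇ-sound (x ∷ xs) t with P? x
  ... | yes px = here px
  ... | no _   = there (anyᵇ-sound xs t)

  anyᵇ-complete : ∀ {xs} → Any P xs → T (anyᵇ xs)
  anyᵇ-complete {x ∷ _} (here px) with P? x
  ... | yes _  = _
  ... | no ¬px = ⊥-elim (¬px px)
  anyᵇ-complete {x ∷ _} (there pxs) with P? x
  ... | yes _  = _
  ... | no _   = anyᵇ-complete pxs

  all-list? : ∀ xs → Dec (All P xs)
  all-list? xs = allᵇ xs because fromEquivalence (allᵇ-sound xs) allᵇ-complete

  any-list? : ∀ xs → Dec (Any P xs)
  any-list? xs = anyᵇ xs because fromEquivalence (anyᵇ-sound xs) anyᵇ-complete

∀-pair? : {P : Pair → Set} → Decidable P → Dec (∀ p → P p)
∀-pair? P? = map′ (λ h p → All.lookup h (∈-allPairs p)) (λ h → All.tabulate λ {p} _ → h p) (all-list? P? allPairs)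

∃-pair? : {P : Pair → Set} → Decidable P → Dec (∃ P)
∃-pair? P? = map′ Any.satisfied (λ (p , h) → Any.map (λ { refl → h }) (∈-allPairs p)) (any-list? P? allPairs)

walk? : {A : Set} {R : A → A → Set} → (∀ a b → Dec (R a b)) → DecidableEquality A → ∀ a l b → Dec (Walk R a l b)
walk? R? _≟ᴬ_ a []      b = a ≟ᴬ b
walk? R? _≟ᴬ_ a (c ∷ l) b = R? a c ×-dec walk? R? _≟ᴬ_ c l b

-- Fits τ (p , q): colouring u by p and v by q is proper, when u's outside
-- neighbour x has colour a and v's outside neighbour y has colour b, τ = (a , b).
Fits : Pair → Pair → Set
Fits (a , b) (p , q) = p ≢ a × q ≢ b × p ≢ q

fits? : ∀ τ p → Dec (Fits τ p)
fits? (a , b) (p , q) = ¬? (p ≟ a) ×-dec ¬? (q ≟ b) ×-dec ¬? (p ≟ q)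

-- Recolouring exactly one of u and v.
Step : Pair → Pair → Set
Step (p , q) (p' , q') = (p ≡ p' × q ≢ q') ⊎ (p ≢ p' × q ≡ q')

step? : ∀ s t → Dec (Step s t)
step? (p , q) (p' , q') = (p ≟ p' ×-dec ¬? (q ≟ q')) ⊎-dec (¬? (p ≟ p') ×-dec q ≟ q')

-- Frames of consecutive colourings of H - {u,v}: at most one of x, y is recoloured.
Shares : Pair → Pair → Set
Shares (a , b) (a' , b') = a ≡ a' ⊎ b ≡ b'

shares? : ∀ τ τ' → Dec (Shares τ τ')
shares? (a , b) (a' , b') = a ≟ a' ⊎-dec b ≟ b'

Twisted : Pair → Set
Twisted (a , b) = a ≢ b

twisted? : ∀ τ → Dec (Twisted τ)
twisted? (a , b) = ¬? (a ≟ b)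

-- The fitting pairs of a frame form, under Step, a 6-cycle if the frame is not
-- twisted and a graph on 7 vertices if it is.  Joinable τ s e is a sufficient
-- condition for a Hamiltonian path of that graph from s to e: for a frame (a , a)
-- the ends must be adjacent on the 6-cycle; for a frame (a , b), a ≢ b, the ends
-- must be distinct and not an Opposite pair {(b , c) , (d , a)} with {c , d} the
-- remaining two colours.
Opposite : Pair → Pair → Pair → Set
Opposite (a , b) (s₁ , s₂) (e₁ , e₂) = s₁ ≡ b × e₂ ≡ a × s₂ ≢ e₁ × s₂ ≢ a × e₁ ≢ b

opposite? : ∀ τ s e → Dec (Opposite τ s e)
opposite? (a , b) (s₁ , s₂) (e₁ , e₂) = s₁ ≟ b ×-dec e₂ ≟ a ×-dec ¬? (s₂ ≟ e₁) ×-dec ¬? (s₂ ≟ a) ×-dec ¬? (e₁ ≟ b)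

Joinable : Pair → Pair → Pair → Set
Joinable τ s e = Fits τ s × Fits τ e × (¬ Twisted τ → Step s e) × (Twisted τ → s ≢ e × ¬ Opposite τ s e × ¬ Opposite τ e s)

joinable? : ∀ τ s e → Dec (Joinable τ s e)
joinable? τ s e =
  fits? τ s ×-dec fits? τ e ×-dec (¬? (twisted? τ) →-dec step? s e) ×-dec
  (twisted? τ →-dec ¬? (s ≟ₚ e) ×-dec ¬? (opposite? τ s e) ×-dec ¬? (opposite? τ e s))

-- s ∷ rest is a Hamiltonian path from s to e in the Step-graph of the pairs fitting τ
-- (it has at least three vertices, since every frame has at least six fitting pairs).
record HamPath (τ s e : Pair) (rest : List Pair) : Set where
  field
    walk     : Walk Step s rest e
    unique   : Unique (s ∷ rest)
    sound    : All (Fits τ) (s ∷ rest)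
    complete : ∀ p → Fits τ p → p ∈ s ∷ rest
    long     : 3 ≤ length (s ∷ rest)

hamPath? : ∀ τ s e rest → Dec (HamPath τ s e rest)
hamPath? τ s e rest =
  map′ (λ (w , u , so , c , l) → record { walk = w ; unique = u ; sound = so ; complete = c ; long = l })
       (λ h → let open HamPath h in walk , unique , sound , complete , long)
       (walk? step? _≟ₚ_ s rest e ×-dec UniqueDec.unique? _≟ₚ_ (s ∷ rest) ×-dec All.all? (fits? τ) (s ∷ rest) ×-dec
        ∀-pair? (λ p → fits? τ p →-dec _∈?_ _≟ₚ_ p (s ∷ rest)) ×-dec 3 ≤? length (s ∷ rest))

-- Depth-first search for a Hamiltonian path of the pairs fitting τ, ending in e;
-- `seen` are the vertices visited so far, the last of them being `current`.
search : (τ e : Pair) → ℕ → (seen : List Pair) → (current : Pair) → Maybe (List Pair)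
search τ e zero       seen current = nothing
search τ e (suc fuel) seen current =
  if does (∀-pair? λ p → fits? τ p →-dec _∈?_ _≟ₚ_ p seen)
  then (if does (current ≟ₚ e) then just [] else nothing)
  else foldr (λ p found → Maybe.map (p ∷_) (search τ e fuel (p ∷ seen) p) <∣> found) nothing
             (filter (λ p → fits? τ p ×-dec step? current p ×-dec ¬? (_∈?_ _≟ₚ_ p seen)) allPairs)

-- The vertices after s of the path found (fuel 8 exceeds the at most 7 fitting pairs).
hamPath : Pair → Pair → Pair → List Pair
hamPath τ s e = fromMaybe [] (search τ e 8 (s ∷ []) s)

witness : {A : Set} (a? : Dec A) → does a? ≡ true → A
witness (yes a) _ = a

-- The four facts about four colours on which the construction rests, each
-- verified by exhaustive computation.  They are opaque so that the (large)
-- proof terms are never unfolded later.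
opaque
  hamPath-correct : ∀ τ s e → Joinable τ s e → HamPath τ s e (hamPath τ s e)
  hamPath-correct = witness (∀-pair? λ τ → ∀-pair? λ s → ∀-pair? λ e →
    joinable? τ s e →-dec hamPath? τ s e (hamPath τ s e)) refl

  bridge : ∀ τ τ' → Shares τ τ' → ∃[ t ] (Fits τ t × Fits τ' t)
  bridge = witness (∀-pair? λ τ → ∀-pair? λ τ' →
    shares? τ τ' →-dec ∃-pair? λ t → fits? τ t ×-dec fits? τ' t) refl

  greedy : ∀ τ τ' s → Shares τ τ' → Fits τ s → ∃[ e ] (Fits τ' e × Joinable τ s e)
  greedy = witness (∀-pair? λ τ → ∀-pair? λ τ' → ∀-pair? λ s →
    shares? τ τ' →-dec fits? τ s →-dec ∃-pair? λ e → fits? τ' e ×-dec joinable? τ s e) refl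

  window : ∀ τ₀ τ₁ τ₂ s e → Twisted τ₀ → Shares τ₀ τ₁ → Shares τ₁ τ₂ → Fits τ₀ s → Fits τ₂ e →
           ∃[ a ] (Joinable τ₀ s a × ∃[ b ] (Joinable τ₁ a b × Joinable τ₂ b e))
  window = witness (∀-pair? λ τ₀ → ∀-pair? λ τ₁ → ∀-pair? λ τ₂ → ∀-pair? λ s → ∀-pair? λ e →
    twisted? τ₀ →-dec shares? τ₀ τ₁ →-dec shares? τ₁ τ₂ →-dec fits? τ₀ s →-dec fits? τ₂ e →-dec
    ∃-pair? λ a → joinable? τ₀ s a ×-dec ∃-pair? λ b → joinable? τ₁ a b ×-dec joinable? τ₂ b e) refl

opposite-moves : ∀ (a : Colour) → opposite a ≢ a
opposite-moves zero                   ()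
opposite-moves (suc zero)             ()
opposite-moves (suc (suc zero))       ()
opposite-moves (suc (suc (suc zero))) ()

module Threading {Idx : Set} (τ : Idx → Pair) (R : Idx → Idx → Set) where

  -- A code (i , s) stands for the i-th colouring extended by the pair s on (u , v).
  Code : Set
  Code = Idx × Pair

  data Move : Code → Code → Set where
    within : ∀ {i s t} → Step s t → Move (i , s) (i , t)
    across : ∀ {i j s} → R i j → Move (i , s) (j , s)

  -- Thread i s is ℓ f: the indices i ∷ is, ending in ℓ, are visited in turn; at each
  -- one a Hamiltonian path through the fitting pairs is followed, the first entered at
  -- s, each left where the next one is entered, and the last left at f.
  data Thread : Idx → Pair → List Idx → Idx → Pair → Set where
    final : ∀ {i s f} → Joinable (τ i) s f → Thread i s [] i f
    then  : ∀ {i s t j is ℓ f} → Joinable (τ i) s t → R i j → Thread j t is ℓ f → Thread i s (j ∷ is) ℓ f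

  block : Idx → Pair → Pair → List Code
  block i s t = map (i ,_) (s ∷ hamPath (τ i) s t)

  trail : ∀ {i s is ℓ f} → Thread i s is ℓ f → List Code
  trail (final {i} {s} {f} _)           = map (i ,_) (hamPath (τ i) s f)
  trail (then {i} {s} {t} {j} _ _ th)   = map (i ,_) (hamPath (τ i) s t) ++ (j , t) ∷ trail th

  codes : ∀ {i s is ℓ f} → Thread i s is ℓ f → List Code
  codes {i} {s} th = (i , s) ∷ trail th

  module _ {i s t} (J : Joinable (τ i) s t) where
    open HamPath (hamPath-correct (τ i) s t J)

    block-walk : Walk Move (i , s) (map (i ,_) (hamPath (τ i) s t)) (i , t)
    block-walk = walk-map (i ,_) within _ walk

    block-sound : ∀ {k p} → (k , p) ∈ block i s t → k ≡ i × Fits (τ i) p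
    block-sound kp∈ with ∈-map⁻ (i ,_) kp∈
    ... | p , p∈ , refl = refl , All.lookup sound p∈

    block-complete : ∀ {p} → Fits (τ i) p → (i , p) ∈ block i s t
    block-complete fits = ∈-map⁺ (i ,_) (complete _ fits)

    block-unique : Unique (block i s t)
    block-unique = Unique.map⁺ (cong proj₂) unique

    block-long : 3 ≤ length (block i s t)
    block-long = ≤-trans long (≤-reflexive (sym (length-map (i ,_) (s ∷ hamPath (τ i) s t))))

  thread-walk : ∀ {i s is ℓ f} (th : Thread i s is ℓ f) → Walk Move (i , s) (trail th) (ℓ , f)
  thread-walk (final J)     = block-walk J
  thread-walk (then J r th) = walk-++ _ (block-walk J) (across r) (thread-walk th)

  thread-cycle : ∀ {i s is ℓ} (th : Thread i s is ℓ s) → R ℓ i → Cycle Move (i , s) (trail th)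
  thread-cycle th r = _ , thread-walk th , across r

  thread-sound : ∀ {i s is ℓ f k p} (th : Thread i s is ℓ f) → (k , p) ∈ codes th → k ∈ i ∷ is × Fits (τ k) p
  thread-sound (final J) kp∈ with block-sound J kp∈
  ... | refl , fits = here refl , fits
  thread-sound (then {t = t} J r th) kp∈ with ∈-++⁻ (block _ _ t) kp∈
  ... | inj₁ kp∈block with block-sound J kp∈block
  ...   | refl , fits = here refl , fits
  thread-sound (then J r th) kp∈ | inj₂ kp∈th with thread-sound th kp∈th
  ...   | k∈ , fits = there k∈ , fits

  thread-complete : ∀ {i s is ℓ f k p} (th : Thread i s is ℓ f) → k ∈ i ∷ is → Fits (τ k) p → (k , p) ∈ codes th
  thread-complete (final J)     (here refl) fits = block-complete J fits
  thread-complete (then J r th) (here refl) fits = ∈-++⁺ˡ (block-complete J fits)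
  thread-complete (then {t = t} J r th) (there k∈) fits = ∈-++⁺ʳ (block _ _ t) (thread-complete th k∈ fits)

  thread-unique : ∀ {i s is ℓ f} (th : Thread i s is ℓ f) → Unique (i ∷ is) → Unique (codes th)
  thread-unique (final J)     _                 = block-unique J
  thread-unique (then J r th) (i∉is ∷ uniq-is) =
    Unique.++⁺ (block-unique J) (thread-unique th uniq-is) disjoint
    where
    disjoint : ∀ {x} → ¬ (x ∈ _ × x ∈ codes th)
    disjoint (x∈block , x∈th) with block-sound J x∈block | thread-sound th x∈th
    ... | refl , _ | i∈is , _ = All.lookup i∉is i∈is refl

  thread-long : ∀ {i s is ℓ f} (th : Thread i s is ℓ f) → 3 ≤ length (codes th)
  thread-long (final J)                 = block-long J
  thread-long (then {i} {s} {t} J r th) =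
    ≤-trans (block-long J) (≤-trans (m≤m+n _ _) (≤-reflexive (sym (length-++ (block i s t)))))

  module _ (shares : ∀ {i j} → R i j → Shares (τ i) (τ j)) where

    greedy-thread : ∀ {i s is ℓ j} → Walk R i is ℓ → R ℓ j → Fits (τ i) s → ∃[ f ] (Thread i s is ℓ f × Fits (τ j) f)
    greedy-thread {is = []} refl r fits with greedy _ _ _ (shares r) fits
    ... | f , fits-f , J = f , final J , fits-f
    greedy-thread {is = _ ∷ _} (r₁ , w) r fits with greedy _ _ _ (shares r₁) fits
    ... | t , fits-t , J with greedy-thread w r fits-t
    ...   | f , th , fits-f = f , then J r₁ th , fits-f

    -- Around a cycle i₀ ∷ i₁ ∷ i₂ ∷ rest: fix where the block of i₂ is left, thread
    -- greedily through rest back to i₀, and close up with the window at i₀, i₁, i₂.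
    closed-thread : ∀ {i₀ is} → (cyc : Cycle R i₀ is) → 3 ≤ length (i₀ ∷ is) → Twisted (τ i₀) →
                    ∃[ s ] Thread i₀ s is (proj₁ cyc) s
    closed-thread {is = []}     _ (s≤s ()) _
    closed-thread {is = _ ∷ []} _ (s≤s (s≤s ())) _
    closed-thread {is = _ ∷ _ ∷ []} (_ , (r₀₁ , r₁₂ , refl) , r₂₀) _ twisted
      with bridge _ _ (shares r₂₀)
    ... | t , fits₂ , fits₀ with window _ _ _ t t twisted (shares r₀₁) (shares r₁₂) fits₀ fits₂
    ...   | _ , J₀ , _ , J₁ , J₂ = t , then J₀ r₀₁ (then J₁ r₁₂ (final J₂))
    closed-thread {is = _ ∷ _ ∷ _ ∷ _} (_ , (r₀₁ , r₁₂ , r₂₃ , w) , r-close) _ twisted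
      with bridge _ _ (shares r₂₃)
    ... | t , fits₂ , fits₃ with greedy-thread w r-close fits₃
    ...   | f , th , fits₀ with window _ _ _ f t twisted (shares r₀₁) (shares r₁₂) fits₀ fits₂
    ...     | _ , J₀ , _ , J₁ , J₂ = f , then J₀ r₀₁ (then J₁ r₁₂ (then J₂ r₂₃ th))

module TwoVertices {n : ℕ} (H : Graph (suc (suc n))) (u v : Fin (suc (suc n))) (u≢v : u ≢ v) where

  H' : Graph n
  H' = removeTwo H u v u≢v

  emb : Fin n → Fin (suc (suc n))
  emb k = punchIn u (punchIn (punchOut u≢v) k)

  emb-injective : ∀ {k l} → emb k ≡ emb l → k ≡ l
  emb-injective eq = punchIn-injective (punchOut u≢v) _ _ (punchIn-injective u _ _ eq)

  emb≢u : ∀ k → emb k ≢ u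
  emb≢u k = punchInᵢ≢i u _

  emb≢v : ∀ k → emb k ≢ v
  emb≢v k eq = punchInᵢ≢i (punchOut u≢v) k (punchIn-injective u _ _ (trans eq (sym (punchIn-punchOut u≢v))))

  unemb : ∀ z → z ≢ u → z ≢ v → Fin n
  unemb z z≢u z≢v = punchOut {i = punchOut u≢v} {j = punchOut (z≢u ∘ sym)}
                             (λ eq → z≢v (sym (punchOut-injective u≢v (z≢u ∘ sym) eq)))

  emb-unemb : ∀ z z≢u z≢v → emb (unemb z z≢u z≢v) ≡ z
  emb-unemb z z≢u z≢v = trans (cong (punchIn u) (punchIn-punchOut _)) (punchIn-punchOut _)

  data View : Fin (suc (suc n)) → Set where
    is-u   : View u
    is-v   : View v
    is-emb : ∀ k → View (emb k)

  view : ∀ z → View z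
  view z with z ≟ u | z ≟ v
  ... | yes refl | _        = is-u
  ... | no _     | yes refl = is-v
  ... | no z≢u   | no z≢v   = subst View (emb-unemb z z≢u z≢v) (is-emb (unemb z z≢u z≢v))

  extend : ∀ {k} → Coloring n k → Fin k → Fin k → Coloring (suc (suc n)) k
  extend c p q z with z ≟ u | z ≟ v
  ... | yes _  | _      = p
  ... | no _   | yes _  = q
  ... | no z≢u | no z≢v = c (unemb z z≢u z≢v)

  module _ {k} (c : Coloring n k) (p q : Fin k) where

    extend-u : extend c p q u ≡ p
    extend-u with u ≟ u
    ... | yes _  = refl
    ... | no u≢u = ⊥-elim (u≢u refl)

    extend-v : extend c p q v ≡ q
    extend-v with v ≟ u | v ≟ v
    ... | yes v≡u | _     = ⊥-elim (u≢v (sym v≡u))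
    ... | no _    | yes _ = refl
    ... | no _    | no v≢v = ⊥-elim (v≢v refl)

    extend-emb : ∀ l → extend c p q (emb l) ≡ c l
    extend-emb l with emb l ≟ u | emb l ≟ v
    ... | yes eq | _      = ⊥-elim (emb≢u l eq)
    ... | no _   | yes eq = ⊥-elim (emb≢v l eq)
    ... | no a   | no b   = cong c (emb-injective (emb-unemb (emb l) a b))

  module _ {k} {c d : Coloring n k} {p q p' q' : Fin k} where

    same-at-u : p ≡ p' → extend c p q u ≡ extend d p' q' u
    same-at-u p≡p' = trans (extend-u c p q) (trans p≡p' (sym (extend-u d p' q')))

    same-at-v : q ≡ q' → extend c p q v ≡ extend d p' q' v
    same-at-v q≡q' = trans (extend-v c p q) (trans q≡q' (sym (extend-v d p' q')))

    same-at-emb : ∀ {l} → c l ≡ d l → extend c p q (emb l) ≡ extend d p' q' (emb l)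
    same-at-emb {l} eq = trans (extend-emb c p q l) (trans eq (sym (extend-emb d p' q' l)))

    differ-at-u : p ≢ p' → extend c p q u ≢ extend d p' q' u
    differ-at-u p≢p' eq = p≢p' (trans (sym (extend-u c p q)) (trans eq (extend-u d p' q')))

    differ-at-v : q ≢ q' → extend c p q v ≢ extend d p' q' v
    differ-at-v q≢q' eq = q≢q' (trans (sym (extend-v c p q)) (trans eq (extend-v d p' q')))

    differ-at-emb : ∀ {l} → c l ≢ d l → extend c p q (emb l) ≢ extend d p' q' (emb l)
    differ-at-emb {l} cl≢dl eq = cl≢dl (trans (sym (extend-emb c p q l)) (trans eq (extend-emb d p' q' l)))

    extend-injective : PointwiseEq (extend c p q) (extend d p' q') → PointwiseEq c d × p ≡ p' × q ≡ q'
    extend-injective eq =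
      (λ l → trans (sym (extend-emb c p q l)) (trans (eq (emb l)) (extend-emb d p' q' l))) ,
      trans (sym (extend-u c p q)) (trans (eq u) (extend-u d p' q')) ,
      trans (sym (extend-v c p q)) (trans (eq v) (extend-v d p' q'))

    extend-cong : PointwiseEq c d → p ≡ p' → q ≡ q' → PointwiseEq (extend c p q) (extend d p' q')
    extend-cong c≗d p≡p' q≡q' z with view z
    ... | is-u     = same-at-u p≡p'
    ... | is-v     = same-at-v q≡q'
    ... | is-emb l = same-at-emb (c≗d l)

  extend-restrict : ∀ {k} (c : Coloring (suc (suc n)) k) → PointwiseEq (extend (c ∘ emb) (c u) (c v)) c
  extend-restrict c z with view z
  ... | is-u     = extend-u _ _ _
  ... | is-v     = extend-v _ _ _
  ... | is-emb l = extend-emb _ _ _ l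

  module _ {k} {c : Coloring n k} {p q : Fin k} where

    differOnlyAt-u : ∀ {p'} → p ≢ p' → DifferOnlyAt (extend c p q) (extend c p' q) u
    differOnlyAt-u p≢p' = differ-at-u p≢p' , only-u
      where
      only-u : ∀ z → extend c p q z ≢ extend c _ q z → z ≡ u
      only-u z differ with view z
      ... | is-u     = refl
      ... | is-v     = ⊥-elim (differ (same-at-v refl))
      ... | is-emb l = ⊥-elim (differ (same-at-emb refl))

    differOnlyAt-v : ∀ {q'} → q ≢ q' → DifferOnlyAt (extend c p q) (extend c p q') v
    differOnlyAt-v q≢q' = differ-at-v q≢q' , only-v
      where
      only-v : ∀ z → extend c p q z ≢ extend c p _ z → z ≡ v
      only-v z differ with view z
      ... | is-u     = ⊥-elim (differ (same-at-u refl))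
      ... | is-v     = refl
      ... | is-emb l = ⊥-elim (differ (same-at-emb refl))

    differOnlyAt-emb : ∀ {d w} → DifferOnlyAt c d w → DifferOnlyAt (extend c p q) (extend d p q) (emb w)
    differOnlyAt-emb {d} {w} (cw≢dw , only-w) = differ-at-emb cw≢dw , only-emb
      where
      only-emb : ∀ z → extend c p q z ≢ extend d p q z → z ≡ emb w
      only-emb z differ with view z
      ... | is-u     = ⊥-elim (differ (same-at-u refl))
      ... | is-v     = ⊥-elim (differ (same-at-v refl))
      ... | is-emb l = cong emb (only-w l (differ ∘ same-at-emb))

module Core {n : ℕ} (H : Graph (suc (suc n))) {u v x y : Fin (suc (suc n))} (u≢v : u ≢ v) (uv : E H u v)
            (x≢u : x ≢ u) (x≢v : x ≢ v) (ux : E H u x) (x-only : ∀ w → w ≢ u → w ≢ v → E H u w → w ≡ x)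
            (y≢u : y ≢ u) (y≢v : y ≢ v) (vy : E H v y) (y-only : ∀ w → w ≢ u → w ≢ v → E H v w → w ≡ y)
            (y≢x : y ≢ x)
            {m : ℕ} (three≤ : 3 ≤ suc m) (cyc : Fin (suc m) → Coloring n 4)
            (cyc-proper    : ∀ i → Proper (removeTwo H u v u≢v) (cyc i))
            (cyc-complete  : ∀ c → Proper (removeTwo H u v u≢v) c → ∃ λ i → PointwiseEq (cyc i) c)
            (cyc-injective : ∀ i i' → PointwiseEq (cyc i) (cyc i') → i ≡ i')
            (cyc-adjacent  : ∀ i → AdjG (removeTwo H u v u≢v) 1 (cyc i) (cyc (nextIdx i)))
  where

  open TwoVertices H u v u≢v

  x' y' : Fin n
  x' = unemb x x≢u x≢v
  y' = unemb y y≢u y≢v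

  x'≢y' : x' ≢ y'
  x'≢y' eq = y≢x (trans (sym (emb-unemb y y≢u y≢v)) (trans (cong emb (sym eq)) (emb-unemb x x≢u x≢v)))

  u-sees-x' : ∀ {l} → E H u (emb l) → l ≡ x'
  u-sees-x' {l} e = emb-injective (trans (x-only (emb l) (emb≢u l) (emb≢v l) e) (sym (emb-unemb x x≢u x≢v)))

  v-sees-y' : ∀ {l} → E H v (emb l) → l ≡ y'
  v-sees-y' {l} e = emb-injective (trans (y-only (emb l) (emb≢u l) (emb≢v l) e) (sym (emb-unemb y y≢u y≢v)))

  extend-proper : ∀ {c} → Proper H' c → ∀ {p q} → Fits (c x' , c y') (p , q) → Proper H (extend c p q)
  extend-proper {c} c-proper {p} {q} (p≢cx' , q≢cy' , p≢q) = proper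
    where
    col : Coloring (suc (suc n)) 4
    col = extend c p q

    from-u : ∀ b → E H u b → col u ≢ col b
    from-u b e with view b
    ... | is-u = ⊥-elim (irrefl H e)
    ... | is-v = subst₂ _≢_ (sym (extend-u c p q)) (sym (extend-v c p q)) p≢q
    ... | is-emb l with u-sees-x' e
    ...   | refl = subst₂ _≢_ (sym (extend-u c p q)) (sym (extend-emb c p q x')) p≢cx'

    from-v : ∀ b → E H v b → col v ≢ col b
    from-v b e with view b
    ... | is-u = subst₂ _≢_ (sym (extend-v c p q)) (sym (extend-u c p q)) (p≢q ∘ sym)
    ... | is-v = ⊥-elim (irrefl H e)
    ... | is-emb l with v-sees-y' e
    ...   | refl = subst₂ _≢_ (sym (extend-v c p q)) (sym (extend-emb c p q y')) q≢cy'

    proper : Proper H col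
    proper a b e with view a | view b
    ... | is-u     | _        = from-u b e
    ... | is-v     | _        = from-v b e
    ... | is-emb k | is-u     = from-u (emb k) (Graph.sym H e) ∘ sym
    ... | is-emb k | is-v     = from-v (emb k) (Graph.sym H e) ∘ sym
    ... | is-emb k | is-emb l = subst₂ _≢_ (sym (extend-emb c p q k)) (sym (extend-emb c p q l)) (c-proper k l e)

  τ : Fin (suc m) → Pair
  τ i = cyc i x' , cyc i y'

  Near : Fin (suc m) → Fin (suc m) → Set
  Near i j = ∃ (DifferOnlyAt (cyc i) (cyc j))

  near-next : ∀ i → Near i (nextIdx i)
  near-next i = adjG₁⇒differOnlyAt H' (cyc-adjacent i)

  -- A single-vertex step cannot recolour both x' and y'.
  near-shares : ∀ {i j} → Near i j → Shares (τ i) (τ j)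
  near-shares {i} {j} (w , _ , only-w) with cyc i x' ≟ cyc j x' | cyc i y' ≟ cyc j y'
  ... | yes same-x | _          = inj₁ same-x
  ... | no _       | yes same-y = inj₂ same-y
  ... | no moved-x | no moved-y = ⊥-elim (x'≢y' (trans (only-w x' moved-x) (sym (only-w y' moved-y))))

  index-cycle : Cycle Near zero (tabulate suc)
  index-cycle = allFin-cycle near-next

  -- Some colouring of the cycle gives x' and y' different colours.  Otherwise the
  -- colour of x' never changes along the cycle (a step recolouring x' would have to
  -- recolour y' too), yet reversing the colours of any colouring gives another one
  -- of the cycle in which x' has a different colour.
  twisted-index : ∃[ t ] Twisted (τ t)
  twisted-index with any? (λ t → twisted? (τ t))
  ... | yes found = found
  ... | no none = ⊥-elim (opposite-moves (cyc zero x') (trans (sym (same-as-reversed x')) (x'-constant i)))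
    where
    straight : ∀ i → cyc i x' ≡ cyc i y'
    straight i = decidable-stable (cyc i x' ≟ cyc i y') (λ twisted → none (i , twisted))

    step-keeps-x' : ∀ {i j} → cyc i x' ≡ cyc zero x' → Near i j → cyc j x' ≡ cyc zero x'
    step-keeps-x' {i} {j} same (w , _ , only-w) with cyc i x' ≟ cyc j x'
    ... | yes kept  = trans (sym kept) same
    ... | no moved = ⊥-elim (x'≢y' (trans (only-w x' moved) (sym (only-w y' moved-y))))
      where
      moved-y : cyc i y' ≢ cyc j y'
      moved-y eq = moved (trans (straight i) (trans eq (sym (straight j))))

    x'-constant : ∀ i → cyc i x' ≡ cyc zero x'
    x'-constant i = All.lookup (walk-all step-keeps-x' _ refl (proj₁ (proj₂ index-cycle))) (∈-allFin i)

    opposite-injective : ∀ {a b : Colour} → opposite a ≡ opposite b → a ≡ b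
    opposite-injective {a} {b} eq = trans (sym (opposite-involutive a)) (trans (cong opposite eq) (opposite-involutive b))

    reversed : ∃ λ i → PointwiseEq (cyc i) (opposite ∘ cyc zero)
    reversed = cyc-complete (opposite ∘ cyc zero) (recolour-proper H' opposite opposite-injective (cyc-proper zero))

    i : Fin (suc m)
    i = proj₁ reversed

    same-as-reversed : PointwiseEq (cyc i) (opposite ∘ cyc zero)
    same-as-reversed = proj₂ reversed

  t : Fin (suc m)
  t = proj₁ twisted-index

  rotation : ∃[ is ] (Cycle Near t is × allFin (suc m) ↭ t ∷ is)
  rotation = cycle-rotate index-cycle (∈-allFin t)

  is : List (Fin (suc m))
  is = proj₁ rotation

  indices-cycle : Cycle Near t is
  indices-cycle = proj₁ (proj₂ rotation)

  indices-unique : Unique (t ∷ is)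
  indices-unique = PermutationProperties.Unique-resp-↭ (setoid _) (↭⇒↭ₛ (proj₂ (proj₂ rotation))) (Unique.allFin⁺ (suc m))

  indices-complete : ∀ i → i ∈ t ∷ is
  indices-complete i = ∈-resp-↭ (proj₂ (proj₂ rotation)) (∈-allFin i)

  indices-long : 3 ≤ length (t ∷ is)
  indices-long = subst (3 ≤_) (trans (sym (length-tabulate id)) (↭-length (proj₂ (proj₂ rotation)))) three≤

  open Threading τ Near

  closed : ∃[ s ] Thread t s is (proj₁ indices-cycle) s
  closed = closed-thread near-shares indices-cycle indices-long (proj₂ twisted-index)

  thread : Thread t (proj₁ closed) is (proj₁ indices-cycle) (proj₁ closed)
  thread = proj₂ closed

  decode : Code → Coloring (suc (suc n)) 4
  decode (i , (p , q)) = extend (cyc i) p q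

  move-adjacent : ∀ {a b} → Move a b → AdjG H 1 (decode a) (decode b)
  move-adjacent (within (inj₁ (refl , q≢q'))) = differOnlyAt⇒adjG₁ H (differOnlyAt-v q≢q')
  move-adjacent (within (inj₂ (p≢p' , refl))) = differOnlyAt⇒adjG₁ H (differOnlyAt-u p≢p')
  move-adjacent (across (_ , differ))         = differOnlyAt⇒adjG₁ H (differOnlyAt-emb differ)

  decode-injective : ∀ a b → PointwiseEq (decode a) (decode b) → a ≡ b
  decode-injective (i , _) (i' , _) eq with extend-injective eq
  ... | same , refl , refl with cyc-injective i i' same
  ...   | refl = refl

  decode-proper : ∀ {a} → a ∈ codes thread → Proper H (decode a)
  decode-proper {i , _} a∈ = extend-proper (cyc-proper i) (proj₂ (thread-sound thread a∈))

  -- Every proper colouring c of H restricts to some cyc i, and (c u , c v) fits its frame.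
  decode-complete : ∀ c → Proper H c → ∃[ a ] (a ∈ codes thread × PointwiseEq (decode a) c)
  decode-complete c c-proper =
    (i , (c u , c v)) , thread-complete thread (indices-complete i) fits ,
    λ z → trans (extend-cong same refl refl z) (extend-restrict c z)
    where
    restriction : ∃ λ i → PointwiseEq (cyc i) (c ∘ emb)
    restriction = cyc-complete (c ∘ emb) (λ a b e → c-proper (emb a) (emb b) e)

    i : Fin (suc m)
    i = proj₁ restriction

    same : PointwiseEq (cyc i) (c ∘ emb)
    same = proj₂ restriction

    fits : Fits (τ i) (c u , c v)
    fits = (λ eq → c-proper u x ux (trans eq (trans (same x') (cong c (emb-unemb x x≢u x≢v))))) ,
           (λ eq → c-proper v y vy (trans eq (trans (same y') (cong c (emb-unemb y y≢u y≢v))))) ,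
           c-proper u v uv

  hamiltonian : HamiltonianG H 4 1
  hamiltonian =
    hamiltonian-from-cycle H decode (thread-cycle thread (proj₂ (proj₂ indices-cycle)))
      (thread-long thread) (thread-unique thread indices-unique)
      move-adjacent decode-injective decode-proper decode-complete

mainTheorem10 : (n : ℕ) (H : Graph (suc (suc n))) (u v x y : Fin (suc (suc n)))
    → (u≢v : u ≢ v) → E H u v
    → Colorable (removeTwo H u v u≢v) 4
    → UniqueNbrOutside H u u v x → UniqueNbrOutside H v u v y → y ≢ x
    → hIs (removeTwo H u v u≢v) 4 1
    → hIs H 4 1
mainTheorem10 n H u v x y u≢v uv _ (x≢u , x≢v , ux , x-only) (y≢u , y≢v , vy , y-only) y≢x
              (_ , (zero , () , _) , _)
mainTheorem10 n H u v x y u≢v uv _ (x≢u , x≢v , ux , x-only) (y≢u , y≢v , vy , y-only) y≢x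
              (_ , (suc m , three≤ , cyc , proper , complete , injective , adjacent) , _) =
  ≤-refl ,
  Core.hamiltonian H u≢v uv x≢u x≢v ux x-only y≢u y≢v vy y-only y≢x three≤ cyc proper complete injective adjacent ,
  λ j 1≤j j<1 → contradiction 1≤j (<⇒≱ j<1)
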